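{- Let $X=\{2^m: m\ge 0\}\times\{2^k:k\ge 0\}$ and let $E=\{(a,b)\in\mathbb{N}^2: b\le\log_2 a\}\cup\{(a,b)\in\mathbb{N}^2: a\le\log_2 b\}$. For every $M\in\mathbb{N}$ there exist natural numbers $z_0,w_0$ such that the square $S_M=\{(t_1,t_2): z_0\le t_1\le z_0+M,\ w_0\le t_2\le w_0+M\}$ satisfies $S_M\subseteq E$ and $$|FS(X)\cap S_M|\ge \tfrac14 M\log_2 M.$$
   Context: $\log_2$ is the base-2 logarithm. For $X\subseteq\mathbb{N}^2$, $FS(X)$ is the set of all sums $\sum_{x\in F}x$ over nonempty finite subsets $F\subseteq X$ (distinct elements, each used at most once). -}

module Defs where

open import Data.Nat using (ℕ; zero; suc; _+_; _*_; _^_; _≤_)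
open import Data.Product using (_×_; _,_; ∃; ∃-syntax; Σ-syntax)
open import Data.Sum using (_⊎_)
open import Data.List using (List; []; _∷_; length)
open import Data.List.Relation.Unary.All using (All)
open import Data.List.Relation.Unary.Unique.Propositional using (Unique)
open import Relation.Binary.PropositionalEquality using (_≡_; _≢_)

Point : Set
Point = ℕ × ℕ

InX : Point → Set
InX (a , b) = ∃[ m ] ∃[ k ] (a ≡ 2 ^ m × b ≡ 2 ^ k)

sumPoints : List Point → Point
sumPoints [] = (0 , 0)
sumPoints ((a , b) ∷ ps) with sumPoints ps
... | (s , t) = (a + s , b + t)

InFS : Point → Set
InFS p = ∃[ F ] (F ≢ [] × Unique F × All InX F × sumPoints F ≡ p)

-- "b ≤ log₂ a" for natural numbers a, b, encoded exactly as 2^b ≤ a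
-- (for a = 0, log₂ a = -∞ and both sides are false).
LeLog₂ : ℕ → ℕ → Set
LeLog₂ b a = 2 ^ b ≤ a

InE : Point → Set
InE (a , b) = LeLog₂ b a ⊎ LeLog₂ a b

InSquare : ℕ → ℕ → ℕ → Point → Set
InSquare z₀ w₀ M (t₁ , t₂) =
  (z₀ ≤ t₁ × t₁ ≤ z₀ + M) × (w₀ ≤ t₂ × t₂ ≤ w₀ + M)

-- "c ≥ (1/4) M log₂ M" for natural c, M, encoded exactly as
-- 2^(4c) ≥ M^M (for M ≥ 1; for M = 0 the right side M log₂ M is read as 0,
-- and 0^0 = 1 ≤ 2^(4c) holds, matching).
QuarterMLogM≤ : ℕ → ℕ → Set
QuarterMLogM≤ M c = M ^ M ≤ 2 ^ (4 * c)

{-# OPTIONS --safe #-}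
-- Every point of the square itself lies in FS(X). The staircase
-- (1, 2^(b+n-1)), …, (1, 2^(b+1)), (1, 2^b), (2, 2^b) of distinct elements of X
-- sums to (2 + n, 2^(b+n)): the powers telescope. A staircase in the first
-- coordinate and a mirrored one in the second coordinate share no point, so
-- (2^f + 2 + a, 2^e + 2 + j) ∈ FS(X) for all a ≤ e − 2 and j ≤ f. Taking
-- w₀ = 2^(M+2) + 2 and z₀ = 2^(w₀+M) + 2 puts the whole square in FS(X) and,
-- since z₀ exceeds 2^t₂ for every point, in E. It then contains (M+1)² points,
-- far more than (1/4) M log₂ M.
module Submission where

open import Defs
open import Data.Nat using (ℕ; zero; suc; _+_; _*_; _^_; _∸_; _≤_; _<_; z≤n; s≤s)
open import Data.Nat.Properties
open import Data.Product using (_×_; _,_; proj₁; proj₂; ∃-syntax; swap)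
open import Data.Sum using (inj₁)
open import Data.List using (List; []; _∷_; length; _++_; map; cartesianProductWith; upTo)
open import Data.List.Properties using (length-++; length-map; length-upTo; ++-conicalˡ)
open import Data.List.Relation.Unary.All as All using (All; []; _∷_)
import Data.List.Relation.Unary.All.Properties as All
open import Data.List.Relation.Unary.AllPairs using ([]; _∷_)
open import Data.List.Relation.Unary.Unique.Propositional using (Unique)
import Data.List.Relation.Unary.Unique.Propositional.Properties as Unique
open import Data.List.Relation.Binary.Disjoint.Propositional using (Disjoint)
open import Data.List.Membership.Propositional.Properties using (∈-upTo⁻)
open import Relation.Binary.PropositionalEquality
open import Relation.Nullary using (¬_)

infixl 6 _⊕_

_⊕_ : Point → Point → Point
(a , b) ⊕ (c , d) = (a + c , b + d)

⊕-assoc : ∀ p q r → (p ⊕ q) ⊕ r ≡ p ⊕ (q ⊕ r)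
⊕-assoc (a , b) (c , d) (e , f) = cong₂ _,_ (+-assoc a c e) (+-assoc b d f)

sumPoints-∷ : ∀ p ps → sumPoints (p ∷ ps) ≡ p ⊕ sumPoints ps
sumPoints-∷ p ps with sumPoints ps
... | _ = refl

sumPoints-++ : ∀ ps qs → sumPoints (ps ++ qs) ≡ sumPoints ps ⊕ sumPoints qs
sumPoints-++ [] qs with sumPoints qs
... | _ = refl
sumPoints-++ (p ∷ ps) qs = begin
  sumPoints (p ∷ ps ++ qs)           ≡⟨ sumPoints-∷ p (ps ++ qs) ⟩
  p ⊕ sumPoints (ps ++ qs)           ≡⟨ cong (p ⊕_) (sumPoints-++ ps qs) ⟩
  p ⊕ (sumPoints ps ⊕ sumPoints qs)  ≡⟨ sym (⊕-assoc p _ _) ⟩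
  p ⊕ sumPoints ps ⊕ sumPoints qs    ≡⟨ cong (_⊕ sumPoints qs) (sym (sumPoints-∷ p ps)) ⟩
  sumPoints (p ∷ ps) ⊕ sumPoints qs  ∎
  where open ≡-Reasoning

sumPoints-map-swap : ∀ ps → sumPoints (map swap ps) ≡ swap (sumPoints ps)
sumPoints-map-swap [] = refl
sumPoints-map-swap (p ∷ ps) = begin
  sumPoints (swap p ∷ map swap ps)  ≡⟨ sumPoints-∷ (swap p) (map swap ps) ⟩
  swap p ⊕ sumPoints (map swap ps)  ≡⟨ cong (swap p ⊕_) (sumPoints-map-swap ps) ⟩
  swap p ⊕ swap (sumPoints ps)      ≡⟨ swap-⊕ p (sumPoints ps) ⟩
  swap (p ⊕ sumPoints ps)           ≡⟨ cong swap (sym (sumPoints-∷ p ps)) ⟩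
  swap (sumPoints (p ∷ ps))         ∎
  where
  open ≡-Reasoning
  swap-⊕ : ∀ p q → swap p ⊕ swap q ≡ swap (p ⊕ q)
  swap-⊕ (a , b) (c , d) = refl

InX-swap : ∀ {p} → InX p → InX (swap p)
InX-swap (m , k , a≡2^m , b≡2^k) = k , m , b≡2^k , a≡2^m

swap-injective : ∀ {p q : Point} → swap p ≡ swap q → p ≡ q
swap-injective {_ , _} {_ , _} refl = refl

++-InFS : ∀ {F G} → F ≢ [] → Unique F → Unique G → All InX F → All InX G →
          Disjoint F G → InFS (sumPoints (F ++ G))
++-InFS {F} {G} F≢[] F! G! FX GX F#G =
  F ++ G , (λ F++G≡[] → F≢[] (++-conicalˡ F G F++G≡[])) ,
  Unique.++⁺ F! G! F#G , All.++⁺ FX GX , refl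

staircase : ℕ → ℕ → List Point
staircase zero    b = (2 , 2 ^ b) ∷ []
staircase (suc n) b = (1 , 2 ^ (b + n)) ∷ staircase n b

staircase≢[] : ∀ n b → staircase n b ≢ []
staircase≢[] zero    b ()
staircase≢[] (suc n) b ()

sumPoints-staircase : ∀ n b → sumPoints (staircase n b) ≡ (2 + n , 2 ^ (b + n))
sumPoints-staircase zero b =
  cong₂ _,_ refl (trans (+-identityʳ (2 ^ b)) (cong (2 ^_) (sym (+-identityʳ b))))
sumPoints-staircase (suc n) b = begin
  sumPoints ((1 , 2 ^ (b + n)) ∷ staircase n b)        ≡⟨ sumPoints-∷ _ (staircase n b) ⟩
  (1 , 2 ^ (b + n)) ⊕ sumPoints (staircase n b)        ≡⟨ cong ((1 , 2 ^ (b + n)) ⊕_) (sumPoints-staircase n b) ⟩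
  (1 , 2 ^ (b + n)) ⊕ (2 + n , 2 ^ (b + n))            ≡⟨ cong (3 + n ,_) (cong (2 ^ (b + n) +_) (sym (+-identityʳ _))) ⟩
  (3 + n , 2 ^ suc (b + n))                            ≡⟨ cong (λ k → 3 + n , 2 ^ k) (sym (+-suc b n)) ⟩
  (3 + n , 2 ^ (b + suc n))                            ∎
  where open ≡-Reasoning

staircase-InX : ∀ n b → All InX (staircase n b)
staircase-InX zero    b = (1 , b , refl , refl) ∷ []
staircase-InX (suc n) b = (0 , b + n , refl , refl) ∷ staircase-InX n b

staircase-first≤2 : ∀ n b → All (λ p → proj₁ p ≤ 2) (staircase n b)
staircase-first≤2 zero    b = ≤-refl ∷ []
staircase-first≤2 (suc n) b = s≤s z≤n ∷ staircase-first≤2 n b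

staircase-second≥2^b : ∀ n b → All (λ p → 2 ^ b ≤ proj₂ p) (staircase n b)
staircase-second≥2^b zero    b = ≤-refl ∷ []
staircase-second≥2^b (suc n) b = ^-monoʳ-≤ 2 (m≤m+n b n) ∷ staircase-second≥2^b n b

-- Only the bottom step (2, 2^b) can share its second coordinate with a step above it.
staircase-unit<2^top : ∀ n b → All (λ p → proj₁ p ≡ 1 → proj₂ p < 2 ^ (b + n)) (staircase n b)
staircase-unit<2^top zero    b = (λ ()) ∷ []
staircase-unit<2^top (suc n) b rewrite +-suc b n =
  (λ _ → 2^k<2^1+k) ∷ All.map (λ below 1≡ → <-trans (below 1≡) 2^k<2^1+k) (staircase-unit<2^top n b)
  where
  2^k<2^1+k : 2 ^ (b + n) < 2 ^ suc (b + n)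
  2^k<2^1+k = ^-monoʳ-< 2 (s≤s (s≤s z≤n)) (n<1+n (b + n))

staircase-unique : ∀ n b → Unique (staircase n b)
staircase-unique zero    b = [] ∷ []
staircase-unique (suc n) b =
  All.map (λ below top≡p → <-irrefl (sym (cong proj₂ top≡p)) (below (sym (cong proj₁ top≡p))))
          (staircase-unit<2^top n b)
  ∷ staircase-unique n b

offset∈FS : ∀ {e f} a j → 2 + a ≤ e → j ≤ f → InFS (2 ^ f + 2 + a , 2 ^ e + 2 + j)
offset∈FS {e} {f} a j 2+a≤e j≤f = subst InFS sum≡
  (++-InFS (staircase≢[] a b)
           (staircase-unique a b) (Unique.map⁺ swap-injective (staircase-unique j c))
           (staircase-InX a b) (All.map⁺ (All.map InX-swap (staircase-InX j c)))
           disjoint)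
  where
  b c : ℕ
  b = e ∸ a
  c = f ∸ j

  sum≡ : sumPoints (staircase a b ++ map swap (staircase j c)) ≡ (2 ^ f + 2 + a , 2 ^ e + 2 + j)
  sum≡ = begin
    sumPoints (staircase a b ++ map swap (staircase j c))
      ≡⟨ sumPoints-++ (staircase a b) _ ⟩
    sumPoints (staircase a b) ⊕ sumPoints (map swap (staircase j c))
      ≡⟨ cong₂ _⊕_ (sumPoints-staircase a b)
                   (trans (sumPoints-map-swap (staircase j c)) (cong swap (sumPoints-staircase j c))) ⟩
    (2 + a , 2 ^ (b + a)) ⊕ (2 ^ (c + j) , 2 + j)
      ≡⟨ cong₂ (λ x y → (2 + a , 2 ^ x) ⊕ (2 ^ y , 2 + j))
               (m∸n+n≡m (m+n≤o⇒n≤o 2 2+a≤e)) (m∸n+n≡m j≤f) ⟩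
    (2 + a , 2 ^ e) ⊕ (2 ^ f , 2 + j)
      ≡⟨ cong₂ _,_ (trans (+-comm (2 + a) (2 ^ f)) (sym (+-assoc (2 ^ f) 2 a)))
                   (sym (+-assoc (2 ^ e) 2 j)) ⟩
    (2 ^ f + 2 + a , 2 ^ e + 2 + j) ∎
    where open ≡-Reasoning

  -- Second coordinates are at least 2^b ≥ 4 in the first staircase, at most 2 in the mirrored one.
  disjoint : Disjoint (staircase a b) (map swap (staircase j c))
  disjoint (v∈A , v∈B) = 4≰2 (≤-trans 4≤2^b (≤-trans
    (All.lookup (staircase-second≥2^b a b) v∈A)
    (All.lookup (All.map⁺ (staircase-first≤2 j c)) v∈B)))
    where
    4≤2^b : 4 ≤ 2 ^ b
    4≤2^b = ^-monoʳ-≤ 2 (m+n≤o⇒m≤o∸n 2 2+a≤e)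
    4≰2 : ¬ 4 ≤ 2
    4≰2 (s≤s (s≤s ()))

square⊆E : ∀ {z₀ w₀ M} → 2 ^ (w₀ + M) ≤ z₀ → ∀ p → InSquare z₀ w₀ M p → InE p
square⊆E 2^top≤z₀ (t₁ , t₂) ((z₀≤t₁ , _) , (_ , t₂≤top)) =
  inj₁ (≤-trans (^-monoʳ-≤ 2 t₂≤top) (≤-trans 2^top≤z₀ z₀≤t₁))

length-cartesianProductWith : ∀ {A B C : Set} (f : A → B → C) xs ys →
  length (cartesianProductWith f xs ys) ≡ length xs * length ys
length-cartesianProductWith f []       ys = refl
length-cartesianProductWith f (x ∷ xs) ys = begin
  length (map (f x) ys ++ cartesianProductWith f xs ys)
    ≡⟨ length-++ (map (f x) ys) ⟩
  length (map (f x) ys) + length (cartesianProductWith f xs ys)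
    ≡⟨ cong₂ _+_ (length-map (f x) ys) (length-cartesianProductWith f xs ys) ⟩
  length ys + length xs * length ys ∎
  where open ≡-Reasoning

grid : ℕ → ℕ → ℕ → List Point
grid z₀ w₀ M = cartesianProductWith (λ a j → (z₀ + a , w₀ + j)) (upTo (suc M)) (upTo (suc M))

grid-unique : ∀ z₀ w₀ M → Unique (grid z₀ w₀ M)
grid-unique z₀ w₀ M =
  Unique.cartesianProductWith⁺ _ offset-injective (Unique.upTo⁺ (suc M)) (Unique.upTo⁺ (suc M))
  where
  offset-injective : ∀ {a a′ j j′} → (z₀ + a , w₀ + j) ≡ (z₀ + a′ , w₀ + j′) → a ≡ a′ × j ≡ j′
  offset-injective eq = +-cancelˡ-≡ z₀ _ _ (cong proj₁ eq) , +-cancelˡ-≡ w₀ _ _ (cong proj₂ eq)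

length-grid : ∀ z₀ w₀ M → length (grid z₀ w₀ M) ≡ suc M * suc M
length-grid z₀ w₀ M = trans (length-cartesianProductWith _ (upTo (suc M)) (upTo (suc M)))
                            (cong₂ _*_ (length-upTo (suc M)) (length-upTo (suc M)))

grid-All : ∀ {P : Point → Set} z₀ w₀ M →
           (∀ a j → a ≤ M → j ≤ M → P (z₀ + a , w₀ + j)) → All P (grid z₀ w₀ M)
grid-All z₀ w₀ M P-offset =
  All.cartesianProductWith⁺ (setoid ℕ) (setoid ℕ) _ (upTo (suc M)) (upTo (suc M))
    (λ a∈ j∈ → P-offset _ _ (≤-pred (∈-upTo⁻ a∈)) (≤-pred (∈-upTo⁻ j∈)))

offset∈square : ∀ {z₀ w₀ M a j} → a ≤ M → j ≤ M → InSquare z₀ w₀ M (z₀ + a , w₀ + j)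
offset∈square {z₀} {w₀} a≤M j≤M =
  (m≤m+n z₀ _ , +-monoʳ-≤ z₀ a≤M) , (m≤m+n w₀ _ , +-monoʳ-≤ w₀ j≤M)

n<2^n : ∀ n → n < 2 ^ n
n<2^n zero    = s≤s z≤n
n<2^n (suc n) = +-mono-≤ (m^n>0 2 n) (subst (suc n ≤_) (sym (+-identityʳ (2 ^ n))) (n<2^n n))

quarterMLogM≤square : ∀ M → QuarterMLogM≤ M (suc M * suc M)
quarterMLogM≤square M = begin
  M ^ M                        ≤⟨ ^-monoˡ-≤ M (<⇒≤ (n<2^n M)) ⟩
  (2 ^ M) ^ M                  ≡⟨ ^-*-assoc 2 M M ⟩
  2 ^ (M * M)                  ≤⟨ ^-monoʳ-≤ 2 (≤-trans (*-mono-≤ (n≤1+n M) (n≤1+n M))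
                                                       (m≤n*m (suc M * suc M) 4)) ⟩
  2 ^ (4 * (suc M * suc M))    ∎
  where open ≤-Reasoning

proposition1p5 : (M : ℕ) → ∃[ z₀ ] ∃[ w₀ ]
    ( (∀ p → InSquare z₀ w₀ M p → InE p)
    × ∃[ L ] (Unique L × All (λ p → InSquare z₀ w₀ M p × InFS p) L
              × QuarterMLogM≤ M (length L)) )
proposition1p5 M =
  z₀ , w₀ , square⊆E (m≤m+n (2 ^ f) 2) ,
  grid z₀ w₀ M , grid-unique z₀ w₀ M ,
  grid-All z₀ w₀ M (λ a j a≤M j≤M →
    offset∈square a≤M j≤M , offset∈FS a j (+-monoʳ-≤ 2 a≤M) (≤-trans j≤M (m≤n+m M w₀))) ,
  subst (QuarterMLogM≤ M) (sym (length-grid z₀ w₀ M)) (quarterMLogM≤square M)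
  where
  e w₀ f z₀ : ℕ
  e  = 2 + M
  w₀ = 2 ^ e + 2
  f  = w₀ + M
  z₀ = 2 ^ f + 2
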